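{- Let $f$ be any honest function. Then the Dedekind cut of the real number $\alpha^f$ is elementary.
   Context: A function $D:\mathbb{Q}\to\{0,1\}$ is the Dedekind cut of the real $\beta$ if $D(q)=0\iff q<\beta$. A function is elementary if it can be generated from $2^x$, $\max$, $0$, successor and projections by composition and bounded primitive recursion; a relation is elementary if its characteristic function is. Rationals are coded into $\mathbb{N}$ in a standard elementary way. A function $f:\mathbb{N}\to\mathbb{N}$ is honest if $f(x)\le f(x+1)$, $f(x)\ge 2^x$ for all $x$, and the relation $f(x)=y$ is elementary. Let $P_i$ be the $i$-th prime ($P_0=2$). Define $g(0)=1$, $g(j+1)=P_j^{2(j+2)(g(j)+1)^3}$, $h(i)=g(f(i)+i)$, $\alpha^f_n=\sum_{i=0}^nP_i^{ -h(i)}$ and $\alpha^f=\lim_{n\to\infty}\alpha^f_n$. -}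

module Defs where

open import Data.Nat using (ℕ; zero; suc; _+_; _*_; _∸_; _^_; _≤_; _⊔_; _!)
open import Data.Nat.Primality using (Prime; prime?)

open import Data.Fin using (Fin)
open import Data.Vec using (Vec; []; _∷_; head; tail; lookup)
open import Data.Integer using (ℤ; +_; -_)
open import Data.Rational.Unnormalised using (ℚᵘ; mkℚᵘ; 0ℚᵘ) renaming (_+_ to _+q_; _<_ to _<q_)
open import Data.Product using (Σ; _×_; ∃)
open import Data.Sum using (_⊎_)
open import Relation.Nullary using (yes; no)
open import Relation.Binary.PropositionalEquality using (_≡_)
open import Function.Bundles using (_⇔_)

rec : {n : ℕ} → (Vec ℕ n → ℕ) → (Vec ℕ (suc (suc n)) → ℕ) → ℕ → Vec ℕ n → ℕ
rec g h zero    v = g v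
rec g h (suc y) v = h (y ∷ rec g h y v ∷ v)

data IsElementary : (n : ℕ) → (Vec ℕ n → ℕ) → Set where
  el-exp2  : IsElementary 1 (λ v → 2 ^ head v)
  el-max   : IsElementary 2 (λ v → head v ⊔ head (tail v))
  el-zero  : IsElementary 0 (λ _ → 0)
  el-suc   : IsElementary 1 (λ v → suc (head v))
  el-proj  : {n : ℕ} (i : Fin n) → IsElementary n (λ v → lookup v i)
  el-comp  : {m n : ℕ} {g : Vec ℕ m → ℕ} {hs : Fin m → Vec ℕ n → ℕ} →
             IsElementary m g → ((i : Fin m) → IsElementary n (hs i)) →
             IsElementary n (λ v → g (Data.Vec.tabulate (λ i → hs i v)))
  el-bprec : {n : ℕ} {g : Vec ℕ n → ℕ} {h : Vec ℕ (suc (suc n)) → ℕ}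
             {j : Vec ℕ (suc n) → ℕ} →
             IsElementary n g → IsElementary (suc (suc n)) h →
             IsElementary (suc n) j →
             ((v : Vec ℕ (suc n)) → rec g h (head v) (tail v) ≤ j v) →
             IsElementary (suc n) (λ v → rec g h (head v) (tail v))
  el-ext   : {n : ℕ} {f f′ : Vec ℕ n → ℕ} →
             IsElementary n f → ((v : Vec ℕ n) → f v ≡ f′ v) → IsElementary n f′

-- A relation R ⊆ ℕⁿ is elementary if its characteristic function is
-- (characteristic function: value 0 on members, 1 on non-members,
-- matching the convention D(q)=0 for the Dedekind cut).
ElementaryRel : (n : ℕ) → (Vec ℕ n → Set) → Set
ElementaryRel n R = Σ (Vec ℕ n → ℕ) λ χ →
  IsElementary n χ × ((v : Vec ℕ n) → (χ v ≡ 0 ⊎ χ v ≡ 1)) ×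
  ((v : Vec ℕ n) → (χ v ≡ 0 ⇔ R v))

Honest : (ℕ → ℕ) → Set
Honest f = ((x : ℕ) → f x ≤ f (suc x)) × ((x : ℕ) → 2 ^ x ≤ f x) ×
           ElementaryRel 2 (λ v → f (head v) ≡ head (tail v))

-- Primes: P 0 = 2, P (i+1) = least prime > P i (found by search; by
-- Euclid's argument there is one in the range (p, p! + 1]).

firstPrimeFrom : ℕ → ℕ → ℕ
firstPrimeFrom k zero = k
firstPrimeFrom k (suc fuel) with prime? k
... | yes _ = k
... | no  _ = firstPrimeFrom (suc k) fuel

P : ℕ → ℕ
P zero    = 2
P (suc i) = firstPrimeFrom (suc (P i)) (P i !)

g : ℕ → ℕ
g zero    = 1
g (suc j) = P j ^ (2 * (j + 2) * ((g j + 1) ^ 3))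

hf : (ℕ → ℕ) → ℕ → ℕ
hf f i = g (f i + i)

-- the rational 1 / m (for m ≥ 1)
inv : ℕ → ℚᵘ
inv m = mkℚᵘ (+ 1) (m ∸ 1)

αₙ : (ℕ → ℕ) → ℕ → ℚᵘ
αₙ f zero    = inv (P 0 ^ hf f 0)
αₙ f (suc n) = αₙ f n +q inv (P (suc n) ^ hf f (suc n))

-- q < α^f  where α^f = lim α^f_n.  Since (α^f_n) is strictly increasing,
-- α^f = sup_n α^f_n, so q < α^f iff q < α^f_n for some n.
_<α[_] : ℚᵘ → (ℕ → ℕ) → Set
q <α[ f ] = ∃ λ n → q <q αₙ f n

-- Coding of rationals: the triple (s, a, b) codes (-1)^[s≠0] · a/(b+1).

decodeℚ : ℕ → ℕ → ℕ → ℚᵘ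
decodeℚ zero    a b = mkℚᵘ (+ a) b
decodeℚ (suc _) a b = mkℚᵘ (- (+ a)) b

DedekindCutElementary : (ℕ → ℕ) → Set
DedekindCutElementary f =
  ElementaryRel 3 (λ v → decodeℚ (head v) (head (tail v)) (head (tail (tail v))) <α[ f ])

-- With E k = P k ^ h k the partial sums of α^f are A k / D k, where D k = ∏_{i<k} E i.
-- The growth of g gives D k ^ 2 ≤ E k, so the tail of the series after k is below 2 / E k.
-- For q = a / (b + 1) put M = 2 (b + 1): there is a first k ≤ M with M · D k < E k
-- (before it D k ≤ M, whereas D M ≥ 2 ^ M), and for that k, q < α^f iff a · D k ≤ (b + 1) · A k.
-- Up to that k every E j is below M ^ 4, so the test only needs the values E j ⊓ (M ^ 4 + 1).
-- These are elementary: P and g capped at a bound are computed by bounded recursion, and f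
-- capped at a bound by bounded search through its elementary graph.

{-# OPTIONS --safe #-}
module Submission where

open import Defs
open import Data.Nat
open import Data.Nat.Properties
open import Data.Vec using (Vec; []; _∷_; head; tail; lookup)
open import Data.Vec.Properties using (tabulate∘lookup)
open import Data.Fin using (Fin; zero; suc)
open import Relation.Binary.PropositionalEquality
open import Function.Bundles using (_⇔_; mk⇔; Equivalence)
open import Data.Product using (_×_; _,_; proj₁; proj₂; ∃)
open import Data.Sum using (_⊎_; inj₁; inj₂)
open import Relation.Nullary using (yes; no; contradiction)
open import Relation.Binary.Definitions using (tri<; tri≈; tri>)
open import Data.Nat.Divisibility using (_∣_; divides)
open import Data.Nat.Primality using (Prime; prime; prime?; Composite; prime⇒nonTrivial; prime⇒¬composite)
open import Data.Nat.Divisibility.Core using (hasNonTrivialDivisor)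
open import Data.Nat.Tactic.RingSolver using (solve-∀)
open import Data.Integer as ℤ using (+_)
import Data.Integer.Properties as ℤ
open import Data.Rational.Unnormalised using (ℚᵘ; mkℚᵘ; ↥_; ↧_; ↧ₙ_; *<*) renaming (_+_ to _+q_; _<_ to _<q_)

-- Elementary functions

record Elementary₁ (F : ℕ → ℕ) : Set where
  constructor elementary₁
  field isElementary : IsElementary 1 (λ v → F (lookup v zero))

record Elementary₂ (F : ℕ → ℕ → ℕ) : Set where
  constructor elementary₂
  field isElementary : IsElementary 2 (λ v → F (lookup v zero) (lookup v (suc zero)))

record Elementary₃ (F : ℕ → ℕ → ℕ → ℕ) : Set where
  constructor elementary₃
  field
    isElementary : IsElementary 3 (λ v → F (lookup v zero) (lookup v (suc zero)) (lookup v (suc (suc zero))))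

module _ {n : ℕ} where

  ap₁ : {F : ℕ → ℕ} {a : Vec ℕ n → ℕ} →
        Elementary₁ F → IsElementary n a → IsElementary n (λ v → F (a v))
  ap₁ {a = a} (elementary₁ e) ea = el-comp {hs = λ _ → a} e (λ _ → ea)

  ap₂ : {F : ℕ → ℕ → ℕ} {a b : Vec ℕ n → ℕ} →
        Elementary₂ F → IsElementary n a → IsElementary n b → IsElementary n (λ v → F (a v) (b v))
  ap₂ {a = a} {b} (elementary₂ e) ea eb =
    el-comp {hs = λ { zero → a ; (suc _) → b }} e (λ { zero → ea ; (suc _) → eb })

  ap₃ : {F : ℕ → ℕ → ℕ → ℕ} {a b c : Vec ℕ n → ℕ} →
        Elementary₃ F → IsElementary n a → IsElementary n b → IsElementary n c →
        IsElementary n (λ v → F (a v) (b v) (c v))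
  ap₃ {a = a} {b} {c} (elementary₃ e) ea eb ec =
    el-comp {hs = λ { zero → a ; (suc zero) → b ; (suc (suc _)) → c }} e
            (λ { zero → ea ; (suc zero) → eb ; (suc (suc _)) → ec })

  el-const : (c : ℕ) → IsElementary n (λ _ → c)
  el-const zero    = el-comp {m = 0} {hs = λ ()} el-zero (λ ())
  el-const (suc c) = ap₁ (elementary₁ (el-ext el-suc λ { (_ ∷ []) → refl })) (el-const c)

x₀ : {n : ℕ} → IsElementary (1 + n) (λ v → lookup v zero)
x₀ = el-proj zero

x₁ : {n : ℕ} → IsElementary (2 + n) (λ v → lookup v (suc zero))
x₁ = el-proj (suc zero)

x₂ : {n : ℕ} → IsElementary (3 + n) (λ v → lookup v (suc (suc zero)))
x₂ = el-proj (suc (suc zero))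

bounded-recursion : {n : ℕ} (F : Vec ℕ (suc n) → ℕ)
  {G : Vec ℕ n → ℕ} {H : Vec ℕ (2 + n) → ℕ} {J : Vec ℕ (suc n) → ℕ} →
  IsElementary n G → IsElementary (2 + n) H → IsElementary (suc n) J →
  (∀ v → F (0 ∷ v) ≡ G v) → (∀ k v → F (suc k ∷ v) ≡ H (k ∷ F (k ∷ v) ∷ v)) →
  (∀ k v → F (k ∷ v) ≤ J (k ∷ v)) → IsElementary (suc n) F
bounded-recursion {n} F {G} {H} {J} eG eH eJ F-zero F-suc F-bound =
  el-ext (el-bprec eG eH eJ bound) (λ { (k ∷ v) → rec≡F k v })
  where
  rec≡F : ∀ k v → rec G H k v ≡ F (k ∷ v)
  rec≡F zero    v = sym (F-zero v)
  rec≡F (suc k) v = trans (cong (λ r → H (k ∷ r ∷ v)) (rec≡F k v)) (sym (F-suc k v))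
  bound : (v : Vec ℕ (suc n)) → rec G H (head v) (tail v) ≤ J v
  bound (k ∷ v) = subst (_≤ J (k ∷ v)) (sym (rec≡F k v)) (F-bound k v)

ElementaryRel-cong : ∀ {n} {R R′ : Vec ℕ n → Set} → (∀ v → R v ⇔ R′ v) → ElementaryRel n R → ElementaryRel n R′
ElementaryRel-cong R⇔R′ (χ , χ-elementary , χ-0-or-1 , χ≡0⇔R) =
  χ , χ-elementary , χ-0-or-1 ,
  λ v → mk⇔ (λ χ≡0 → to (R⇔R′ v) (to (χ≡0⇔R v) χ≡0)) (λ r′ → from (χ≡0⇔R v) (from (R⇔R′ v) r′))
  where open Equivalence

n<2^n : ∀ n → n < 2 ^ n
n<2^n zero    = s≤s z≤n
n<2^n (suc n) = +-mono-≤ (m^n>0 2 n) (≤-trans (n<2^n n) (m≤m+n (2 ^ n) 0))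

n≤2^n : ∀ n → n ≤ 2 ^ n
n≤2^n n = <⇒≤ (n<2^n n)

m^n≤2^[m*n] : ∀ m n → m ^ n ≤ 2 ^ (m * n)
m^n≤2^[m*n] m n = ≤-trans (^-monoˡ-≤ n (n≤2^n m)) (≤-reflexive (^-*-assoc 2 m n))

suc-elementary : Elementary₁ suc
suc-elementary = elementary₁ (el-ext el-suc λ { (_ ∷ []) → refl })

2^-elementary : Elementary₁ (2 ^_)
2^-elementary = elementary₁ (el-ext el-exp2 λ { (_ ∷ []) → refl })

⊔-elementary : Elementary₂ _⊔_
⊔-elementary = elementary₂ (el-ext el-max λ { (_ ∷ _ ∷ []) → refl })

+-elementary : Elementary₂ _+_
+-elementary = elementary₂ (bounded-recursion _ x₀ (ap₁ suc-elementary x₁)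
  (ap₁ 2^-elementary (ap₁ suc-elementary (ap₂ ⊔-elementary x₀ x₁)))
  (λ { (_ ∷ []) → refl }) (λ { _ (_ ∷ []) → refl }) (λ { k (n ∷ []) → +-bound k n }))
  where
  +-bound : ∀ m n → m + n ≤ 2 ^ suc (m ⊔ n)
  +-bound m n = +-mono-≤ (≤-trans (m≤m⊔n m n) (n≤2^n _))
                         (≤-trans (m≤n⊔m m n) (≤-trans (n≤2^n _) (m≤m+n _ 0)))

*-elementary : Elementary₂ _*_
*-elementary = elementary₂ (bounded-recursion _ (el-const 0) (ap₂ +-elementary x₂ x₁)
  (ap₁ 2^-elementary (ap₂ +-elementary x₀ x₁))
  (λ { (_ ∷ []) → refl }) (λ { _ (_ ∷ []) → refl }) (λ { k (n ∷ []) → *-bound k n }))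
  where
  *-bound : ∀ m n → m * n ≤ 2 ^ (m + n)
  *-bound m n = ≤-trans (*-mono-≤ (n≤2^n m) (n≤2^n n)) (≤-reflexive (sym (^-distribˡ-+-* 2 m n)))

pred-elementary : Elementary₁ pred
pred-elementary = elementary₁ (bounded-recursion _ (el-const 0) x₀ x₀
  (λ { [] → refl }) (λ { _ [] → refl }) (λ { _ [] → pred[n]≤n }))

∸-elementary : Elementary₂ _∸_
∸-elementary = elementary₂ (ap₂ flipped x₁ x₀)
  where
  flipped : Elementary₂ (λ n m → m ∸ n)
  flipped = elementary₂ (bounded-recursion _ x₀ (ap₁ pred-elementary x₁) x₁
    (λ { (_ ∷ []) → refl }) (λ { n (m ∷ []) → sym (pred[m∸n]≡m∸[1+n] m n) })
    (λ { n (m ∷ []) → m∸n≤m m n }))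

^-elementary : Elementary₂ _^_
^-elementary = elementary₂ (ap₂ flipped x₁ x₀)
  where
  flipped : Elementary₂ (λ n m → m ^ n)
  flipped = elementary₂ (bounded-recursion _ (el-const 1) (ap₂ *-elementary x₂ x₁)
    (ap₁ 2^-elementary (ap₂ *-elementary x₁ x₀))
    (λ { (_ ∷ []) → refl }) (λ { _ (_ ∷ []) → refl }) (λ { n (m ∷ []) → m^n≤2^[m*n] m n }))

!-elementary : Elementary₁ _!
!-elementary = elementary₁ (bounded-recursion _ (el-const 1)
  (ap₂ *-elementary (ap₁ suc-elementary x₀) x₁) (ap₁ 2^-elementary (ap₂ *-elementary x₀ x₀))
  (λ { [] → refl }) (λ { _ [] → refl }) (λ { n [] → ≤-trans (n!≤n^n n) (m^n≤2^[m*n] n n) }))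
  where
  n!≤n^n : ∀ n → n ! ≤ n ^ n
  n!≤n^n zero    = ≤-refl
  n!≤n^n (suc n) = *-monoʳ-≤ (suc n) (≤-trans (n!≤n^n n) (^-monoˡ-≤ n (n≤1+n n)))

ifZero : ℕ → ℕ → ℕ → ℕ
ifZero zero    x y = x
ifZero (suc _) x y = y

ifZero-elementary : Elementary₃ ifZero
ifZero-elementary = elementary₃ (el-ext
  (ap₂ +-elementary (ap₂ *-elementary x₁ (ap₂ ∸-elementary (el-const 1) x₀))
                    (ap₂ *-elementary x₂ (ap₂ ∸-elementary (el-const 1) (ap₂ ∸-elementary (el-const 1) x₀))))
  λ { (c ∷ x ∷ y ∷ []) → arithmetised c x y })
  where
  arithmetised : ∀ c x y → x * (1 ∸ c) + y * (1 ∸ (1 ∸ c)) ≡ ifZero c x y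
  arithmetised zero    x y = trans (cong₂ _+_ (*-identityʳ x) (*-zeroʳ y)) (+-identityʳ x)
  arithmetised (suc zero)    x y = cong₂ _+_ (*-zeroʳ x) (*-identityʳ y)
  arithmetised (suc (suc c)) x y = cong₂ _+_ (*-zeroʳ x) (*-identityʳ y)

⊓-elementary : Elementary₂ _⊓_
⊓-elementary = elementary₂ (el-ext (ap₂ ∸-elementary x₀ (ap₂ ∸-elementary x₀ x₁))
  λ { (m ∷ n ∷ []) → m∸[m∸n]≡m⊓n m n })
  where
  m∸[m∸n]≡m⊓n : ∀ m n → m ∸ (m ∸ n) ≡ m ⊓ n
  m∸[m∸n]≡m⊓n zero    zero    = refl
  m∸[m∸n]≡m⊓n zero    (suc n) = refl
  m∸[m∸n]≡m⊓n (suc m) zero    = n∸n≡0 (suc m)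
  m∸[m∸n]≡m⊓n (suc m) (suc n) = trans (+-∸-assoc 1 (m∸n≤m m n)) (cong suc (m∸[m∸n]≡m⊓n m n))

∣-∣-elementary : Elementary₂ ∣_-_∣
∣-∣-elementary = elementary₂ (el-ext (ap₂ +-elementary (ap₂ ∸-elementary x₀ x₁) (ap₂ ∸-elementary x₁ x₀))
  λ { (m ∷ n ∷ []) → ∸+∸≡∣-∣ m n })
  where
  ∸+∸≡∣-∣ : ∀ m n → (m ∸ n) + (n ∸ m) ≡ ∣ m - n ∣
  ∸+∸≡∣-∣ zero    zero    = refl
  ∸+∸≡∣-∣ zero    (suc n) = refl
  ∸+∸≡∣-∣ (suc m) zero    = +-identityʳ (suc m)
  ∸+∸≡∣-∣ (suc m) (suc n) = ∸+∸≡∣-∣ m n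

ifZero-∸-< : ∀ {m n} x y → m < n → ifZero (n ∸ m) x y ≡ y
ifZero-∸-< {zero}  {suc n} x y _         = refl
ifZero-∸-< {suc m} {suc n} x y (s≤s m<n) = ifZero-∸-< x y m<n

-- Bounded minimisation

LeastZero : (ℕ → ℕ) → ℕ → ℕ → Set
LeastZero t k m = m ≤ k × (∀ j → j < m → t j ≢ 0) × (m < k → t m ≡ 0)

μ : (ℕ → ℕ) → ℕ → ℕ
μ t zero    = 0
μ t (suc k) = ifZero (k ∸ μ t k) (ifZero (t k) k (suc k)) (μ t k)

μ-leastZero : ∀ t k → LeastZero t k (μ t k)
μ-leastZero t zero = z≤n , (λ _ ()) , (λ ())
μ-leastZero t (suc k) with μ t k | μ-leastZero t k
... | m | m≤k , below , found with m≤n⇒m<n∨m≡n m≤k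
...   | inj₁ m<k rewrite ifZero-∸-< (ifZero (t k) k (suc k)) m m<k =
  m≤n⇒m≤1+n m≤k , below , λ _ → found m<k
...   | inj₂ refl rewrite n∸n≡0 m with t m in tm
...     | zero  = n≤1+n m , below , λ _ → tm
...     | suc _ = ≤-refl , below′ , λ m<m → contradiction m<m (<-irrefl refl)
  where
  below′ : ∀ j → j < suc m → t j ≢ 0
  below′ j j<1+m with m<1+n⇒m<n∨m≡n j<1+m
  ... | inj₁ j<m  = below j j<m
  ... | inj₂ refl = λ tj → 0≢1+n (trans (sym tj) tm)

LeastZero-unique : ∀ {t k m m′} → LeastZero t k m → LeastZero t k m′ → m ≡ m′
LeastZero-unique (m≤k , below , found) (m′≤k , below′ , found′) with <-cmp _ _
... | tri< m<m′ _ _ = contradiction (found (<-≤-trans m<m′ m′≤k)) (below′ _ m<m′)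
... | tri≈ _ m≡m′ _ = m≡m′
... | tri> _ _ m′<m = contradiction (found′ (<-≤-trans m′<m m≤k)) (below _ m′<m)

μ-≤ : ∀ t k → μ t k ≤ k
μ-≤ t k = proj₁ (μ-leastZero t k)

μ-minimal : ∀ t k {j} → j < μ t k → t j ≢ 0
μ-minimal t k = proj₁ (proj₂ (μ-leastZero t k)) _

μ-found : ∀ t k → μ t k < k → t (μ t k) ≡ 0
μ-found t k = proj₂ (proj₂ (μ-leastZero t k))

μ-least : ∀ t k {j} → j < k → t j ≡ 0 → μ t k ≤ j
μ-least t k {j} j<k tj = ≮⇒≥ λ j<μ → μ-minimal t k j<μ tj

μ<⇔∃ : ∀ t k → μ t k < k ⇔ ∃ λ j → j < k × t j ≡ 0
μ<⇔∃ t k = mk⇔ (λ μ<k → μ t k , μ<k , μ-found t k μ<k)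
                (λ (j , j<k , tj) → ≤-<-trans (μ-least t k j<k tj) j<k)

μ-cong : ∀ {t t′} → (∀ j → t j ≡ t′ j) → ∀ k → μ t k ≡ μ t′ k
μ-cong t≗t′ zero = refl
μ-cong t≗t′ (suc k) rewrite μ-cong t≗t′ k | t≗t′ k = refl

μ-zero : ∀ t k → t 0 ≡ 0 → μ t (suc k) ≡ 0
μ-zero t k t0 = n≤0⇒n≡0 (μ-least t (suc k) z<s t0)

μ-shift : ∀ t k → t 0 ≢ 0 → μ t (suc k) ≡ suc (μ (λ j → t (suc j)) k)
μ-shift t k t0≢0 = LeastZero-unique (μ-leastZero t (suc k)) shifted
  where
  t′ : ℕ → ℕ
  t′ j = t (suc j)
  below : ∀ j → j < suc (μ t′ k) → t j ≢ 0
  below zero    _         = t0≢0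
  below (suc j) (s≤s j<μ) = μ-minimal t′ k j<μ
  shifted : LeastZero t (suc k) (suc (μ t′ k))
  shifted = s≤s (μ-≤ t′ k) , below , λ μ<k → μ-found t′ k (≤-pred μ<k)

μ-graph : ∀ {t c} → (∀ y → t y ≡ 0 ⇔ c ≡ y) → ∀ L → μ t L ≡ c ⊓ L
μ-graph {t} {c} graph L = LeastZero-unique (μ-leastZero t L) leastZero
  where
  open Equivalence
  leastZero : LeastZero t L (c ⊓ L)
  leastZero with c ≤? L
  ... | yes c≤L rewrite m≤n⇒m⊓n≡m c≤L =
    c≤L , (λ j j<c tj → <-irrefl (sym (to (graph j) tj)) j<c) , λ _ → from (graph c) refl
  ... | no c≰L rewrite m≥n⇒m⊓n≡n (<⇒≤ (≰⇒> c≰L)) =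
    ≤-refl , (λ j j<L tj → c≰L (≤-trans (≤-reflexive (to (graph j) tj)) (<⇒≤ j<L))) , λ L<L → contradiction L<L (<-irrefl refl)

μ-elementary : {n : ℕ} {t : Vec ℕ (suc n) → ℕ} → IsElementary (suc n) t →
               IsElementary (suc n) (λ v → μ (λ j → t (j ∷ tail v)) (head v))
μ-elementary {n} {t} et = bounded-recursion _ (el-const 0)
  (ap₃ ifZero-elementary (ap₂ ∸-elementary x₀ x₁)
       (ap₃ ifZero-elementary (skipSecond et) x₀ (ap₁ suc-elementary x₀)) x₁)
  x₀ (λ _ → refl) (λ _ _ → refl) (λ k _ → μ-≤ _ k)
  where
  skipSecond : {u : Vec ℕ (suc n) → ℕ} → IsElementary (suc n) u →
               IsElementary (2 + n) (λ w → u (head w ∷ tail (tail w)))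
  skipSecond {u} eu = el-ext (el-comp {hs = λ i w → lookup w (σ i)} eu (λ i → el-proj (σ i)))
    λ { (k ∷ _ ∷ v) → cong (λ v′ → u (k ∷ v′)) (tabulate∘lookup v) }
    where
    σ : Fin (suc n) → Fin (2 + n)
    σ zero    = zero
    σ (suc i) = suc (suc i)

μ-elementary₂ : {t : ℕ → ℕ → ℕ} → Elementary₂ t → Elementary₂ (λ k x → μ (λ j → t j x) k)
μ-elementary₂ (elementary₂ et) = elementary₂ (el-ext (μ-elementary et) λ { (_ ∷ _ ∷ []) → refl })

μ-elementary₃ : {t : ℕ → ℕ → ℕ → ℕ} → Elementary₃ t → Elementary₃ (λ k x y → μ (λ j → t j x y) k)
μ-elementary₃ (elementary₃ et) = elementary₃ (el-ext (μ-elementary et) λ { (_ ∷ _ ∷ _ ∷ []) → refl })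

-- Primality

∃<-test : (ℕ → ℕ) → ℕ → ℕ
∃<-test t k = suc (μ t k) ∸ k

∃<-test≡0⇔∃ : ∀ t k → ∃<-test t k ≡ 0 ⇔ ∃ λ j → j < k × t j ≡ 0
∃<-test≡0⇔∃ t k = mk⇔ (λ eq → to (μ<⇔∃ t k) (m∸n≡0⇒m≤n eq))
                      (λ ∃j → m≤n⇒m∸n≡0 (from (μ<⇔∃ t k) ∃j))
  where open Equivalence

∃<-test-elementary₂ : {t : ℕ → ℕ → ℕ} → Elementary₂ t → Elementary₂ (λ k x → ∃<-test (λ j → t j x) k)
∃<-test-elementary₂ et = elementary₂ (ap₂ ∸-elementary (ap₁ suc-elementary (ap₂ (μ-elementary₂ et) x₀ x₁)) x₀)

∃<-test-elementary₃ : {t : ℕ → ℕ → ℕ → ℕ} → Elementary₃ t → Elementary₃ (λ k x y → ∃<-test (λ j → t j x y) k)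
∃<-test-elementary₃ et =
  elementary₃ (ap₂ ∸-elementary (ap₁ suc-elementary (ap₃ (μ-elementary₃ et) x₀ x₁ x₂)) x₀)

divisibilityTest : ℕ → ℕ → ℕ
divisibilityTest d n = ∃<-test (λ q → ∣ q * d - n ∣) (suc n)

divisibilityTest≡0⇔∣ : ∀ d n → divisibilityTest d n ≡ 0 ⇔ d ∣ n
divisibilityTest≡0⇔∣ d n = mk⇔
  (λ eq → let (q , _ , q*d≡n) = to (∃<-test≡0⇔∃ _ (suc n)) eq in divides q (sym (∣m-n∣≡0⇒m≡n q*d≡n)))
  (λ d∣n → let (q , q≤n , q*d≡n) = small-quotient d∣n in
           from (∃<-test≡0⇔∃ _ (suc n)) (q , s≤s q≤n , m≡n⇒∣m-n∣≡0 q*d≡n))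
  where
  open Equivalence
  small-quotient : ∀ {d n} → d ∣ n → ∃ λ q → q ≤ n × q * d ≡ n
  small-quotient {zero}  (divides q n≡q*0) = 0 , z≤n , sym (trans n≡q*0 (*-zeroʳ q))
  small-quotient {suc d} (divides q n≡q*d) = q , subst (q ≤_) (sym n≡q*d) (m≤m*n q (suc d)) , sym n≡q*d

divisibilityTest-elementary : Elementary₂ divisibilityTest
divisibilityTest-elementary = elementary₂
  (ap₃ (∃<-test-elementary₃ {t = λ q d n → ∣ q * d - n ∣}
         (elementary₃ (ap₂ ∣-∣-elementary (ap₂ *-elementary x₀ x₁) x₂)))
       (ap₁ suc-elementary x₁) x₀ x₁)

compositeTest : ℕ → ℕ
compositeTest n = ∃<-test (λ d → (2 ∸ d) + divisibilityTest d n) n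

compositeTest≡0⇔Composite : ∀ n → compositeTest n ≡ 0 ⇔ Composite n
compositeTest≡0⇔Composite n = mk⇔
  (λ eq → let (d , d<n , t≡0) = to (∃<-test≡0⇔∃ _ n) eq in
          hasNonTrivialDivisor {{n>1⇒nonTrivial (m∸n≡0⇒m≤n (m+n≡0⇒m≡0 (2 ∸ d) t≡0))}} d<n
                               (to (divisibilityTest≡0⇔∣ d n) (m+n≡0⇒n≡0 (2 ∸ d) t≡0)))
  (λ { (hasNonTrivialDivisor {d} d<n d∣n) → from (∃<-test≡0⇔∃ _ n)
         (d , d<n , cong₂ _+_ (m≤n⇒m∸n≡0 (nonTrivial⇒n>1 d)) (from (divisibilityTest≡0⇔∣ d n) d∣n)) })
  where open Equivalence

compositeTest-elementary : Elementary₁ compositeTest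
compositeTest-elementary = elementary₁
  (ap₂ (∃<-test-elementary₂ {t = λ d n → (2 ∸ d) + divisibilityTest d n}
         (elementary₂ (ap₂ +-elementary (ap₂ ∸-elementary (el-const 2) x₀)
                                        (ap₂ divisibilityTest-elementary x₀ x₁))))
       x₀ x₀)

primeTest : ℕ → ℕ
primeTest n = (2 ∸ n) + (1 ∸ compositeTest n)

primeTest≡0⇔Prime : ∀ n → primeTest n ≡ 0 ⇔ Prime n
primeTest≡0⇔Prime n = mk⇔
  (λ eq → prime {{n>1⇒nonTrivial (m∸n≡0⇒m≤n (m+n≡0⇒m≡0 (2 ∸ n) eq))}}
                (λ c → contradiction (from (compositeTest≡0⇔Composite n) c)
                                     (m<n⇒n≢0 (m∸n≡0⇒m≤n (m+n≡0⇒n≡0 (2 ∸ n) eq)))))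
  (λ p → cong₂ _+_ (m≤n⇒m∸n≡0 (nonTrivial⇒n>1 n {{prime⇒nonTrivial p}}))
                   (m≤n⇒m∸n≡0 (n≢0⇒n>0 λ c≡0 → prime⇒¬composite p (to (compositeTest≡0⇔Composite n) c≡0))))
  where open Equivalence

primeTest-elementary : Elementary₁ primeTest
primeTest-elementary = elementary₁
  (ap₂ +-elementary (ap₂ ∸-elementary (el-const 2) x₀)
                    (ap₂ ∸-elementary (el-const 1) (ap₁ compositeTest-elementary x₀)))

firstPrimeFrom≡ : ∀ k fuel → firstPrimeFrom k fuel ≡ k + μ (λ j → primeTest (k + j)) fuel
firstPrimeFrom≡ k zero = sym (+-identityʳ k)
firstPrimeFrom≡ k (suc fuel) with prime? k
... | yes k-prime = sym (begin
  k + μ (λ j → primeTest (k + j)) (suc fuel)       ≡⟨ cong (λ m → k + m) (μ-zero _ fuel k+0-prime) ⟩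
  k + 0                                            ≡⟨ +-identityʳ k ⟩
  k                                                ∎)
  where
  open ≡-Reasoning
  k+0-prime : primeTest (k + 0) ≡ 0
  k+0-prime = Equivalence.from (primeTest≡0⇔Prime (k + 0)) (subst Prime (sym (+-identityʳ k)) k-prime)
... | no ¬k-prime = begin
  firstPrimeFrom (suc k) fuel                      ≡⟨ firstPrimeFrom≡ (suc k) fuel ⟩
  suc k + μ (λ j → primeTest (suc k + j)) fuel     ≡⟨ cong (λ m → suc k + m) (μ-cong (λ j → cong primeTest (sym (+-suc k j))) fuel) ⟩
  suc k + μ (λ j → primeTest (k + suc j)) fuel     ≡⟨ sym (+-suc k _) ⟩
  k + suc (μ (λ j → primeTest (k + suc j)) fuel)   ≡⟨ cong (λ m → k + m) (sym (μ-shift _ fuel k+0-not-prime)) ⟩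
  k + μ (λ j → primeTest (k + j)) (suc fuel)       ∎
  where
  open ≡-Reasoning
  k+0-not-prime : primeTest (k + 0) ≢ 0
  k+0-not-prime eq = ¬k-prime (subst Prime (+-identityʳ k) (Equivalence.to (primeTest≡0⇔Prime (k + 0)) eq))

firstPrimeFrom-elementary : Elementary₂ firstPrimeFrom
firstPrimeFrom-elementary = elementary₂ (el-ext
  (ap₂ +-elementary x₀ (ap₂ (μ-elementary₂ {t = λ j k → primeTest (k + j)}
                               (elementary₂ (ap₁ primeTest-elementary (ap₂ +-elementary x₁ x₀))))
                            x₁ x₀))
  λ { (k ∷ fuel ∷ []) → sym (firstPrimeFrom≡ k fuel) })

-- The primes P and the function g, capped

monotone-from-step : {F : ℕ → ℕ} → (∀ k → F k ≤ F (suc k)) → ∀ {i j} → i ≤ j → F i ≤ F j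
monotone-from-step step {j = zero}  z≤n = ≤-refl
monotone-from-step step {j = suc j} i≤1+j with m≤n⇒m<n∨m≡n i≤1+j
... | inj₁ i<1+j = ≤-trans (monotone-from-step step (≤-pred i<1+j)) (step j)
... | inj₂ refl  = ≤-refl

m≤m^n : ∀ m {n} → 1 ≤ n → m ≤ m ^ n
m≤m^n zero    _ = z≤n
m≤m^n (suc m) {suc n} _ = subst (_≤ suc m * suc m ^ n) (*-identityʳ (suc m))
                                (*-monoʳ-≤ (suc m) (m^n>0 (suc m) n))

n<m^n : ∀ {m} n → 2 ≤ m → n < m ^ n
n<m^n n 2≤m = <-≤-trans (n<2^n n) (^-monoˡ-≤ n 2≤m)

n≤n^n : ∀ n → n ≤ n ^ n
n≤n^n zero    = z≤n
n≤n^n (suc n) = m≤m^n (suc n) {suc n} (s≤s z≤n)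

[m⊓n]^k⊓n≡m^k⊓n : ∀ m n {k} → 1 ≤ k → (m ⊓ n) ^ k ⊓ n ≡ m ^ k ⊓ n
[m⊓n]^k⊓n≡m^k⊓n m n {k} 1≤k with m ≤? n
... | yes m≤n rewrite m≤n⇒m⊓n≡m m≤n = refl
... | no m≰n rewrite m≥n⇒m⊓n≡n (<⇒≤ (≰⇒> m≰n)) =
  trans (m≥n⇒m⊓n≡n (m≤m^n n 1≤k))
        (sym (m≥n⇒m⊓n≡n (≤-trans (<⇒≤ (≰⇒> m≰n)) (m≤m^n m 1≤k))))

[m⊓n]^[k⊓n]⊓n≡m^k⊓n : ∀ m n {k} → 2 ≤ m → 1 ≤ k → (m ⊓ n) ^ (k ⊓ n) ⊓ n ≡ m ^ k ⊓ n
[m⊓n]^[k⊓n]⊓n≡m^k⊓n m n {k} 2≤m 1≤k with k ≤? n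
... | yes k≤n rewrite m≤n⇒m⊓n≡m k≤n = [m⊓n]^k⊓n≡m^k⊓n m n 1≤k
... | no k≰n rewrite m≥n⇒m⊓n≡n (<⇒≤ (≰⇒> k≰n)) =
  trans (m≥n⇒m⊓n≡n n≤[m⊓n]^n) (sym (m≥n⇒m⊓n≡n (<⇒≤ (<-trans (≰⇒> k≰n) (n<m^n k 2≤m)))))
  where
  n≤[m⊓n]^n : n ≤ (m ⊓ n) ^ n
  n≤[m⊓n]^n with m ≤? n
  ... | yes m≤n rewrite m≤n⇒m⊓n≡m m≤n = <⇒≤ (n<m^n n 2≤m)
  ... | no m≰n rewrite m≥n⇒m⊓n≡n (<⇒≤ (≰⇒> m≰n)) = n≤n^n n

-- Once F reaches the cap L it stays there, and below the cap `step` yields the next capped value.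
capped-elementary : {F : ℕ → ℕ} {step : ℕ → ℕ → ℕ → ℕ} → (∀ k → F k ≤ F (suc k)) →
                    Elementary₃ step → (∀ k L → F k < L → step k (F k) L ≡ F (suc k) ⊓ L) →
                    Elementary₂ (λ k L → F k ⊓ L)
capped-elementary {F} {step} F-step step-elementary step-caps = elementary₂ (bounded-recursion _
  (ap₂ ⊓-elementary (el-const (F 0)) x₀)
  (ap₃ ifZero-elementary (ap₂ ∸-elementary x₂ x₁) x₂ (ap₃ step-elementary x₀ x₁ x₂))
  x₁
  (λ { (_ ∷ []) → refl }) (λ { k (L ∷ []) → capped-step k L }) (λ { _ (L ∷ []) → m⊓n≤n _ L }))
  where
  capped-step : ∀ k L → F (suc k) ⊓ L ≡ ifZero (L ∸ (F k ⊓ L)) L (step k (F k ⊓ L) L)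
  capped-step k L with L ≤? F k
  ... | yes L≤F rewrite m≥n⇒m⊓n≡n L≤F | n∸n≡0 L = m≥n⇒m⊓n≡n (≤-trans L≤F (F-step k))
  ... | no L≰F rewrite m≤n⇒m⊓n≡m (<⇒≤ (≰⇒> L≰F)) | ifZero-∸-< L (step k (F k) L) (≰⇒> L≰F) =
    sym (step-caps k L (≰⇒> L≰F))

P<P[1+i] : ∀ i → P i < P (suc i)
P<P[1+i] i = subst (suc (P i) ≤_) (sym (firstPrimeFrom≡ (suc (P i)) (P i !))) (m≤m+n (suc (P i)) _)

2≤P : ∀ i → 2 ≤ P i
2≤P zero    = ≤-refl
2≤P (suc i) = ≤-trans (2≤P i) (<⇒≤ (P<P[1+i] i))

P-capped-elementary : Elementary₂ (λ k L → P k ⊓ L)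
P-capped-elementary = capped-elementary {step = λ _ p L → firstPrimeFrom (suc p) (p !) ⊓ L}
  (λ i → <⇒≤ (P<P[1+i] i))
  (elementary₃ (ap₂ ⊓-elementary (ap₂ firstPrimeFrom-elementary (ap₁ suc-elementary x₁) (ap₁ !-elementary x₁)) x₂))
  (λ _ _ _ → refl)

1+m≤2[m+1]³ : ∀ m → suc m ≤ 2 * (m + 1) ^ 3
1+m≤2[m+1]³ m = subst (_≤ 2 * (m + 1) ^ 3) (+-comm m 1) (≤-trans (m≤m^n (m + 1) {3} (s≤s z≤n)) (m≤m+n _ _))

2[g+1]³≤exponent : ∀ j → 2 * (g j + 1) ^ 3 ≤ 2 * (j + 2) * (g j + 1) ^ 3
2[g+1]³≤exponent j = *-monoˡ-≤ ((g j + 1) ^ 3) (*-monoʳ-≤ 2 (≤-trans (s≤s z≤n) (m≤n+m 2 j)))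

1≤exponent : ∀ j → 1 ≤ 2 * (j + 2) * (g j + 1) ^ 3
1≤exponent j = ≤-trans (s≤s z≤n) (≤-trans (1+m≤2[m+1]³ (g j)) (2[g+1]³≤exponent j))

2[g+1]³≤g[1+j] : ∀ j → 2 * (g j + 1) ^ 3 ≤ g (suc j)
2[g+1]³≤g[1+j] j = ≤-trans (2[g+1]³≤exponent j) (<⇒≤ (n<m^n (2 * (j + 2) * (g j + 1) ^ 3) (2≤P j)))

g<g[1+j] : ∀ j → g j < g (suc j)
g<g[1+j] j = ≤-trans (1+m≤2[m+1]³ (g j)) (2[g+1]³≤g[1+j] j)

g-monotone : ∀ {i j} → i ≤ j → g i ≤ g j
g-monotone = monotone-from-step (λ j → <⇒≤ (g<g[1+j] j))

j<g : ∀ j → j < g j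
j<g zero    = s≤s z≤n
j<g (suc j) = <-≤-trans (s≤s (j<g j)) (g<g[1+j] j)

P≤g[1+j] : ∀ j → P j ≤ g (suc j)
P≤g[1+j] j = m≤m^n (P j) (1≤exponent j)

g[m⊓n+k]⊓n≡g[m+k]⊓n : ∀ m n k → g (m ⊓ n + k) ⊓ n ≡ g (m + k) ⊓ n
g[m⊓n+k]⊓n≡g[m+k]⊓n m n k with m ≤? n
... | yes m≤n rewrite m≤n⇒m⊓n≡m m≤n = refl
... | no m≰n rewrite m≥n⇒m⊓n≡n (<⇒≤ (≰⇒> m≰n)) =
  trans (m≥n⇒m⊓n≡n (≤-trans (m≤m+n n k) (<⇒≤ (j<g (n + k)))))
        (sym (m≥n⇒m⊓n≡n (≤-trans (<⇒≤ (≰⇒> m≰n)) (≤-trans (m≤m+n m k) (<⇒≤ (j<g (m + k)))))))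

g-capped-elementary : Elementary₂ (λ k L → g k ⊓ L)
g-capped-elementary = capped-elementary {step = λ j x L → (P j ⊓ L) ^ (2 * (j + 2) * (x + 1) ^ 3) ⊓ L}
  (λ j → <⇒≤ (g<g[1+j] j))
  (elementary₃ (ap₂ ⊓-elementary
    (ap₂ ^-elementary (ap₂ P-capped-elementary x₀ x₂)
      (ap₂ *-elementary (ap₂ *-elementary (el-const 2) (ap₂ +-elementary x₀ (el-const 2)))
                        (ap₂ ^-elementary (ap₂ +-elementary x₁ (el-const 1)) (el-const 3))))
    x₂))
  (λ j L _ → [m⊓n]^k⊓n≡m^k⊓n (P j) L (1≤exponent j))

-- Series Σ 1 / E k with (∏_{i<k} E i)² ≤ E k

-- Σ_{i<k} 1 / E i = A E k / D E k
D : (ℕ → ℕ) → ℕ → ℕ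
D E zero    = 1
D E (suc k) = D E k * E k

A : (ℕ → ℕ) → ℕ → ℕ
A E zero    = 0
A E (suc k) = A E k * E k + D E k

D-cong : ∀ {E E′} k → (∀ {j} → j < k → E j ≡ E′ j) → D E k ≡ D E′ k
D-cong zero    _   = refl
D-cong (suc k) E≡E′ = cong₂ _*_ (D-cong k (λ j<k → E≡E′ (m<n⇒m<1+n j<k))) (E≡E′ (n<1+n k))

A-cong : ∀ {E E′} k → (∀ {j} → j < k → E j ≡ E′ j) → A E k ≡ A E′ k
A-cong zero    _   = refl
A-cong {E} {E′} (suc k) E≡E′ = cong₂ _+_ (cong₂ _*_ (A-cong k below) (E≡E′ (n<1+n k))) (D-cong k below)
  where
  below : ∀ {j} → j < k → E j ≡ E′ j
  below j<k = E≡E′ (m<n⇒m<1+n j<k)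

D≤B^k : ∀ {E B} → (∀ i → E i ≤ B) → ∀ k → D E k ≤ B ^ k
D≤B^k E≤B zero    = ≤-refl
D≤B^k {B = B} E≤B (suc k) = ≤-trans (*-mono-≤ (D≤B^k E≤B k) (E≤B k)) (≤-reflexive (*-comm (B ^ k) B))

A≤k*B^k : ∀ {E B} → 1 ≤ B → (∀ i → E i ≤ B) → ∀ k → A E k ≤ k * B ^ k
A≤k*B^k         1≤B E≤B zero    = z≤n
A≤k*B^k {E} {B} 1≤B E≤B (suc k) = begin
  A E k * E k + D E k       ≤⟨ +-mono-≤ (*-mono-≤ (A≤k*B^k 1≤B E≤B k) (E≤B k)) (D≤B^k E≤B k) ⟩
  k * B ^ k * B + B ^ k     ≤⟨ +-monoʳ-≤ (k * B ^ k * B) (m≤m*n (B ^ k) B {{>-nonZero 1≤B}}) ⟩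
  k * B ^ k * B + B ^ k * B ≡⟨ regroup k (B ^ k) B ⟩
  suc k * B ^ suc k         ∎
  where
  open ≤-Reasoning
  regroup : ∀ k x B → k * x * B + x * B ≡ (1 + k) * (B * x)
  regroup = solve-∀

1≤D : ∀ {E} → (∀ k → 1 ≤ E k) → ∀ k → 1 ≤ D E k
1≤D 1≤E zero    = ≤-refl
1≤D 1≤E (suc k) = *-mono-≤ (1≤D 1≤E k) (1≤E k)

-- a / b ≤ c / d ≤ e / f, cross-multiplied
cross-≤-trans : ∀ a b c d e f → 1 ≤ d → a * d ≤ c * b → c * f ≤ e * d → a * f ≤ e * b
cross-≤-trans a b c d e f 1≤d ad≤cb cf≤ed = *-cancelʳ-≤ (a * f) (e * b) d {{>-nonZero 1≤d}} (begin
  a * f * d ≡⟨ swap a f d ⟩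
  a * d * f ≤⟨ *-monoˡ-≤ f ad≤cb ⟩
  c * b * f ≡⟨ swap c b f ⟩
  c * f * b ≤⟨ *-monoˡ-≤ b cf≤ed ⟩
  e * d * b ≡⟨ swap e d b ⟩
  e * b * d ∎)
  where
  open ≤-Reasoning
  swap : ∀ x y z → x * y * z ≡ x * z * y
  swap = solve-∀

module _ {E : ℕ → ℕ} (1≤E : ∀ k → 1 ≤ E k) where

  A/D-increasing : ∀ {k m} → k ≤ m → A E k * D E m ≤ A E m * D E k
  A/D-increasing {m = zero}  z≤n = ≤-refl
  A/D-increasing {k} {suc m} k≤1+m with m≤n⇒m<n∨m≡n k≤1+m
  ... | inj₂ refl = ≤-refl
  ... | inj₁ k<1+m = cross-≤-trans (A E k) (D E k) (A E m) (D E m) (A E (suc m)) (D E (suc m)) (1≤D 1≤E m) (A/D-increasing (≤-pred k<1+m)) step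
    where
    step : A E m * D E (suc m) ≤ A E (suc m) * D E m
    step = ≤-trans (≤-reflexive (*-assoc-swap (A E m) (D E m) (E m)))
                   (*-monoˡ-≤ (D E m) (m≤m+n (A E m * E m) (D E m)))
      where
      *-assoc-swap : ∀ x y z → x * (y * z) ≡ x * z * y
      *-assoc-swap = solve-∀

  ≤A/D⇒<A/D[1+m] : ∀ {a N} m → 1 ≤ N → a * D E m ≤ N * A E m → a * D E (suc m) < A E (suc m) * N
  ≤A/D⇒<A/D[1+m] {a} {N} m 1≤N aD≤NA = begin-strict
    a * (D E m * E m)                  ≡⟨ sym (*-assoc a (D E m) (E m)) ⟩
    a * D E m * E m                    ≤⟨ *-monoˡ-≤ (E m) aD≤NA ⟩
    N * A E m * E m                    ≡⟨ *-assoc N (A E m) (E m) ⟩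
    N * (A E m * E m)                  <⟨ m<m+n (N * (A E m * E m)) (*-mono-≤ 1≤N (1≤D 1≤E m)) ⟩
    N * (A E m * E m) + N * D E m      ≡⟨ sym (*-distribˡ-+ N (A E m * E m) (D E m)) ⟩
    N * (A E m * E m + D E m)          ≡⟨ *-comm N _ ⟩
    A E (suc m) * N                    ∎
    where open ≤-Reasoning

module _ {E : ℕ → ℕ} (2≤E : ∀ k → 2 ≤ E k) (D²≤E : ∀ k → D E k * D E k ≤ E k) where

  private
    1≤E : ∀ k → 1 ≤ E k
    1≤E k = ≤-trans (s≤s z≤n) (2≤E k)

  2^k≤D : ∀ k → 2 ^ k ≤ D E k
  2^k≤D zero    = ≤-refl
  2^k≤D (suc k) = ≤-trans (≤-reflexive (*-comm 2 (2 ^ k))) (*-mono-≤ (2^k≤D k) (2≤E k))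

  2D≤E : ∀ k → 2 * D E k ≤ E k
  2D≤E k with m≤n⇒m<n∨m≡n (1≤D 1≤E k)
  ... | inj₁ 2≤D = ≤-trans (*-monoˡ-≤ (D E k) 2≤D) (D²≤E k)
  ... | inj₂ 1≡D = subst (λ d → 2 * d ≤ E k) 1≡D (2≤E k)

  2E≤E[1+k] : ∀ k → 2 * E k ≤ E (suc k)
  2E≤E[1+k] k = ≤-trans (*-monoʳ-≤ 2 (m≤n*m (E k) (D E k) {{>-nonZero (1≤D 1≤E k)}})) (2D≤E (suc k))

  -- (A E (suc k) + D E k) / D E (suc k) = A E k / D E k + 2 / E k bounds the whole tail after k.
  tail-bound-decreasing : ∀ {m k} → m ≤ k →
    (A E (suc k) + D E k) * D E (suc m) ≤ (A E (suc m) + D E m) * D E (suc k)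
  tail-bound-decreasing {k = zero}  z≤n = ≤-refl
  tail-bound-decreasing {m} {suc k} m≤1+k with m≤n⇒m<n∨m≡n m≤1+k
  ... | inj₂ refl = ≤-refl
  ... | inj₁ m<1+k = cross-≤-trans
    (A E (suc (suc k)) + D E (suc k)) (D E (suc (suc k))) (A E (suc k) + D E k) (D E (suc k))
    (A E (suc m) + D E m) (D E (suc m))
    (1≤D 1≤E (suc k)) step (tail-bound-decreasing (≤-pred m<1+k))
    where
    open ≤-Reasoning
    a d e e′ : ℕ
    a = A E k ; d = D E k ; e = E k ; e′ = E (suc k)
    expandˡ : ∀ a d e e′ → ((a * e + d) * e′ + d * e + d * e) * (d * e) ≡ (a * e + d) * e′ * (d * e) + (2 * e) * (d * d * e)
    expandˡ = solve-∀
    expandʳ : ∀ a d e e′ → (a * e + d + d) * (d * e * e′) ≡ (a * e + d) * e′ * (d * e) + e′ * (d * d * e)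
    expandʳ = solve-∀
    step : (A E (suc (suc k)) + D E (suc k)) * D E (suc k) ≤ (A E (suc k) + D E k) * D E (suc (suc k))
    step = begin
      ((a * e + d) * e′ + d * e + d * e) * (d * e)           ≡⟨ expandˡ a d e e′ ⟩
      (a * e + d) * e′ * (d * e) + (2 * e) * (d * d * e)     ≤⟨ +-monoʳ-≤ _ (*-monoˡ-≤ (d * d * e) (2E≤E[1+k] k)) ⟩
      (a * e + d) * e′ * (d * e) + e′ * (d * d * e)          ≡⟨ sym (expandʳ a d e e′) ⟩
      (a * e + d + d) * (d * e * e′)                         ∎

  A/D≤tail-bound : ∀ m k → A E k * D E (suc m) ≤ (A E (suc m) + D E m) * D E k
  A/D≤tail-bound m k with ≤-total k (suc m)
  ... | inj₁ k≤1+m =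
    ≤-trans (A/D-increasing 1≤E k≤1+m) (*-monoˡ-≤ (D E k) (m≤m+n (A E (suc m)) (D E m)))
  A/D≤tail-bound m (suc k) | inj₂ (s≤s m≤k) = cross-≤-trans
    (A E (suc k)) (D E (suc k)) (A E (suc k) + D E k) (D E (suc k)) (A E (suc m) + D E m) (D E (suc m))
    (1≤D 1≤E (suc k)) (*-monoˡ-≤ (D E (suc k)) (m≤m+n (A E (suc k)) (D E k))) (tail-bound-decreasing m≤k)

  above-good-approximant : ∀ {a N} m → 2 * N * D E m < E m → N * A E m < a * D E m →
                           ∀ k → N * A E k < a * D E k
  above-good-approximant {a} {N} m good above k =
    *-cancelʳ-< (D E m * E m) (N * A E k) (a * D E k) (begin-strict
      N * A E k * (d * e)           ≡⟨ *-assoc N (A E k) (d * e) ⟩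
      N * (A E k * (d * e))         ≤⟨ *-monoʳ-≤ N (A/D≤tail-bound m k) ⟩
      N * ((x * e + d + d) * y)     ≡⟨ regroupˡ N x d e y ⟩
      (N * x * e + 2 * N * d) * y   <⟨ *-monoˡ-< y {{>-nonZero (1≤D 1≤E k)}} (+-monoʳ-< (N * x * e) good) ⟩
      (N * x * e + e) * y           ≡⟨ regroupʳ N x e y ⟩
      (N * x + 1) * e * y           ≤⟨ *-monoˡ-≤ y (*-monoˡ-≤ e (subst (_≤ a * d) (+-comm 1 (N * x)) above)) ⟩
      a * d * e * y                 ≡⟨ regroup a d e y ⟩
      a * y * (d * e)               ∎)
    where
    open ≤-Reasoning
    x d e y : ℕ
    x = A E m ; d = D E m ; e = E m ; y = D E k
    regroupˡ : ∀ N x d e y → N * ((x * e + d + d) * y) ≡ (N * x * e + 2 * N * d) * y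
    regroupˡ = solve-∀
    regroupʳ : ∀ N x e y → (N * x * e + e) * y ≡ (N * x + 1) * e * y
    regroupʳ = solve-∀
    regroup : ∀ a d e y → a * d * e * y ≡ a * y * (d * e)
    regroup = solve-∀

partialSum : (ℕ → ℕ) → ℕ → ℚᵘ
partialSum E zero    = inv (E 0)
partialSum E (suc n) = partialSum E n +q inv (E (suc n))

_<Σ[_] : ℚᵘ → (ℕ → ℕ) → Set
q <Σ[ E ] = ∃ λ n → q <q partialSum E n

negative<partialSum : ∀ E a b → mkℚᵘ (ℤ.- (+ a)) b <q partialSum E 0
negative<partialSum E zero    b = *<* (ℤ.+<+ (s≤s z≤n))
negative<partialSum E (suc a) b = *<* ℤ.-<+

module _ {E : ℕ → ℕ} (1≤E : ∀ k → 1 ≤ E k) where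

  private
    ↥-+ : ∀ p q → ↥ (p +q q) ≡ ↥ p ℤ.* ↧ q ℤ.+ ↥ q ℤ.* ↧ p
    ↥-+ (mkℚᵘ _ _) (mkℚᵘ _ _) = refl

    ↧-+ : ∀ p q → ↧ₙ (p +q q) ≡ ↧ₙ p * ↧ₙ q
    ↧-+ (mkℚᵘ _ _) (mkℚᵘ _ _) = refl

    ↧ₙ-inv : ∀ k → ↧ₙ inv (E k) ≡ E k
    ↧ₙ-inv k = suc-pred (E k) {{>-nonZero (1≤E k)}}

  partialSum-↧ : ∀ n → ↧ₙ partialSum E n ≡ D E (suc n)
  partialSum-↧ zero    = trans (↧ₙ-inv 0) (sym (*-identityˡ (E 0)))
  partialSum-↧ (suc n) = trans (↧-+ (partialSum E n) (inv (E (suc n))))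
                               (cong₂ _*_ (partialSum-↧ n) (↧ₙ-inv (suc n)))

  partialSum-↥ : ∀ n → ↥ partialSum E n ≡ + A E (suc n)
  partialSum-↥ zero    = refl
  partialSum-↥ (suc n) = begin
    ↥ (partialSum E n +q inv (E (suc n)))                                 ≡⟨ ↥-+ (partialSum E n) (inv (E (suc n))) ⟩
    ↥ partialSum E n ℤ.* + ↧ₙ inv (E (suc n)) ℤ.+ + 1 ℤ.* + ↧ₙ partialSum E n
      ≡⟨ cong₂ (λ x y → x ℤ.* + ↧ₙ inv (E (suc n)) ℤ.+ + 1 ℤ.* + y) (partialSum-↥ n) (partialSum-↧ n) ⟩
    + A E (suc n) ℤ.* + ↧ₙ inv (E (suc n)) ℤ.+ + 1 ℤ.* + D E (suc n)
      ≡⟨ cong (λ e → + A E (suc n) ℤ.* + e ℤ.+ + 1 ℤ.* + D E (suc n)) (↧ₙ-inv (suc n)) ⟩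
    + A E (suc n) ℤ.* + E (suc n) ℤ.+ + 1 ℤ.* + D E (suc n)
      ≡⟨ cong₂ ℤ._+_ (sym (ℤ.pos-* (A E (suc n)) (E (suc n)))) (ℤ.*-identityˡ (+ D E (suc n))) ⟩
    + (A E (suc n) * E (suc n)) ℤ.+ + D E (suc n)                         ≡⟨ sym (ℤ.pos-+ _ (D E (suc n))) ⟩
    + A E (suc (suc n))                                                   ∎
    where open ≡-Reasoning

  nonnegative<partialSum⇔ : ∀ a b n → mkℚᵘ (+ a) b <q partialSum E n ⇔ a * D E (suc n) < A E (suc n) * suc b
  nonnegative<partialSum⇔ a b n = mk⇔
    (λ { (*<* lt) → ℤ.drop‿+<+ (subst₂ ℤ._<_ lhs rhs lt) })
    (λ lt → *<* (subst₂ ℤ._<_ (sym lhs) (sym rhs) (ℤ.+<+ lt)))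
    where
    lhs : + a ℤ.* ↧ partialSum E n ≡ + (a * D E (suc n))
    lhs = trans (cong (λ d → + a ℤ.* + d) (partialSum-↧ n)) (sym (ℤ.pos-* a (D E (suc n))))
    rhs : ↥ partialSum E n ℤ.* + suc b ≡ + (A E (suc n) * suc b)
    rhs = trans (cong (ℤ._* + suc b) (partialSum-↥ n)) (sym (ℤ.pos-* (A E (suc n)) (suc b)))

-- Deciding the cut

capped : (ℕ → ℕ) → ℕ → ℕ → ℕ
capped E L i = E i ⊓ L

module _ {F : ℕ → ℕ → ℕ} (F-elementary : Elementary₂ F) (F≤L : ∀ i L → F i L ≤ L) where

  private
    F≤1+L : ∀ L i → F i L ≤ suc L
    F≤1+L L i = m≤n⇒m≤1+n (F≤L i L)

  capped-D-elementary : Elementary₂ (λ k L → D (λ i → F i L) k)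
  capped-D-elementary = elementary₂ (bounded-recursion _ (el-const 1)
    (ap₂ *-elementary x₁ (ap₂ F-elementary x₀ x₂))
    (ap₂ ^-elementary (ap₁ suc-elementary x₁) x₀)
    (λ { (_ ∷ []) → refl }) (λ { _ (_ ∷ []) → refl })
    (λ { k (L ∷ []) → D≤B^k (F≤1+L L) k }))

  capped-A-elementary : Elementary₂ (λ k L → A (λ i → F i L) k)
  capped-A-elementary = elementary₂ (bounded-recursion _ (el-const 0)
    (ap₂ +-elementary (ap₂ *-elementary x₁ (ap₂ F-elementary x₀ x₂)) (ap₂ capped-D-elementary x₀ x₂))
    (ap₂ *-elementary x₀ (ap₂ ^-elementary (ap₁ suc-elementary x₁) x₀))
    (λ { (_ ∷ []) → refl }) (λ { _ (_ ∷ []) → refl })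
    (λ { k (L ∷ []) → A≤k*B^k (s≤s z≤n) (F≤1+L L) k }))

margin : ℕ → ℕ
margin b = 2 * suc b

cap : ℕ → ℕ
cap b = suc (margin b * margin b * margin b * margin b)

goodTest : (ℕ → ℕ) → ℕ → ℕ → ℕ
goodTest E b k = suc (margin b * D (capped E (cap b)) k) ∸ capped E (cap b) k

goodIndex : (ℕ → ℕ) → ℕ → ℕ
goodIndex E b = μ (goodTest E b) (suc (margin b))

cutTest : (ℕ → ℕ) → Vec ℕ 3 → ℕ
cutTest E (s ∷ a ∷ b ∷ []) =
  ifZero s (ifZero (a * D (capped E (cap b)) m ∸ suc b * A (capped E (cap b)) m) 0 1) 0
  where m = goodIndex E b

module _ {E : ℕ → ℕ} (2≤E : ∀ k → 2 ≤ E k) (D²≤E : ∀ k → D E k * D E k ≤ E k) (b : ℕ) where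

  private
    N M L m : ℕ
    N = suc b
    M = margin b
    L = cap b
    m = goodIndex E b
    Ẽ : ℕ → ℕ
    Ẽ = capped E L
    1≤E : ∀ k → 1 ≤ E k
    1≤E k = ≤-trans (s≤s z≤n) (2≤E k)
    1≤M : 1 ≤ M
    1≤M = *-mono-≤ (s≤s (z≤n {1})) (s≤s z≤n)

  bad⇒small : ∀ k → (∀ {j} → j < k → Ẽ j ≡ E j) → D E k ≤ M * M * M → goodTest E b k ≢ 0 →
              Ẽ k ≡ E k × E k ≤ M * D E k × D E k ≤ M
  bad⇒small k exact D≤M³ bad = Ẽ≡E , E≤MD , D≤M
    where
    Ẽ≤MD : Ẽ k ≤ M * D E k
    Ẽ≤MD = subst (λ d → Ẽ k ≤ M * d) (D-cong k exact) (≤-pred (m∸n≢0⇒n<m bad))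
    Ẽ<L : Ẽ k < L
    Ẽ<L = s≤s (≤-trans Ẽ≤MD (≤-trans (*-monoʳ-≤ M D≤M³) (≤-reflexive (sym (*-comm (M * M * M) M)))))
    Ẽ≡E : Ẽ k ≡ E k
    Ẽ≡E with E k ≤? L
    ... | yes E≤L = m≤n⇒m⊓n≡m E≤L
    ... | no  E≰L = contradiction Ẽ<L (<-irrefl (m≥n⇒m⊓n≡n (<⇒≤ (≰⇒> E≰L))))
    E≤MD : E k ≤ M * D E k
    E≤MD = subst (_≤ M * D E k) Ẽ≡E Ẽ≤MD
    D≤M : D E k ≤ M
    D≤M = *-cancelʳ-≤ (D E k) M (D E k) {{>-nonZero (1≤D 1≤E k)}} (≤-trans (D²≤E k) E≤MD)

  bad-prefix : ∀ k → (∀ {j} → j < k → goodTest E b j ≢ 0) →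
               (∀ {j} → j < k → Ẽ j ≡ E j) × D E k ≤ M * M * M
  bad-prefix zero    _   = (λ ()) , *-mono-≤ (*-mono-≤ 1≤M 1≤M) 1≤M
  bad-prefix (suc k) bad = exact′ , D≤M³′
    where
    bad-below : ∀ {j} → j < k → goodTest E b j ≢ 0
    bad-below j<k = bad (m<n⇒m<1+n j<k)
    exact : ∀ {j} → j < k → Ẽ j ≡ E j
    exact = proj₁ (bad-prefix k bad-below)
    small : Ẽ k ≡ E k × E k ≤ M * D E k × D E k ≤ M
    small = bad⇒small k exact (proj₂ (bad-prefix k bad-below)) (bad (n<1+n k))
    exact′ : ∀ {j} → j < suc k → Ẽ j ≡ E j
    exact′ j<1+k with m<1+n⇒m<n∨m≡n j<1+k
    ... | inj₁ j<k  = exact j<k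
    ... | inj₂ refl = proj₁ small
    D≤M³′ : D E k * E k ≤ M * M * M
    D≤M³′ = let (_ , E≤MD , D≤M) = small in
      ≤-trans (*-mono-≤ D≤M (≤-trans E≤MD (*-monoʳ-≤ M D≤M))) (≤-reflexive (sym (*-assoc M M M)))

  goodIndex-exact : ∀ {j} → j < m → Ẽ j ≡ E j
  goodIndex-exact = proj₁ (bad-prefix m (μ-minimal (goodTest E b) (suc M)))

  goodIndex≤M : m ≤ M
  goodIndex≤M = ≮⇒≥ λ M<m →
    let bad-below : ∀ {j} → j < M → goodTest E b j ≢ 0
        bad-below j<M = μ-minimal (goodTest E b) (suc M) (<-trans j<M M<m)
        (exact , D≤M³) = bad-prefix M bad-below
        (_ , _ , D≤M) = bad⇒small M exact D≤M³ (μ-minimal (goodTest E b) (suc M) M<m)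
    in contradiction D≤M (<⇒≱ (<-≤-trans (n<2^n M) (2^k≤D 2≤E D²≤E M)))

  goodIndex-good : 2 * N * D E m < E m
  goodIndex-good = begin-strict
    M * D E m         ≡⟨ cong (M *_) (sym (D-cong m goodIndex-exact)) ⟩
    M * D Ẽ m         <⟨ m∸n≡0⇒m≤n (μ-found (goodTest E b) (suc M) (s≤s goodIndex≤M)) ⟩
    Ẽ m               ≤⟨ m⊓n≤m (E m) L ⟩
    E m               ∎
    where open ≤-Reasoning

  goodIndex-decides : ∀ a → a * D E m ≤ N * A E m ⇔ mkℚᵘ (+ a) b <Σ[ E ]
  goodIndex-decides a = mk⇔
    (λ aD≤NA → m , from (nonnegative<partialSum⇔ 1≤E a b m) (≤A/D⇒<A/D[1+m] 1≤E {a} {N} m (s≤s z≤n) aD≤NA))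
    (λ (n , q<αₙ) → ≮⇒≥ λ NA<aD → <-asym (to (nonnegative<partialSum⇔ 1≤E a b n) q<αₙ)
      (subst (_< a * D E (suc n)) (*-comm N (A E (suc n)))
             (above-good-approximant 2≤E D²≤E {a} {N} m goodIndex-good NA<aD (suc n))))
    where open Equivalence

  cutTest-nonnegative : ∀ a → cutTest E (0 ∷ a ∷ b ∷ []) ≡ 0 ⇔ mkℚᵘ (+ a) b <Σ[ E ]
  cutTest-nonnegative a = mk⇔
    (λ test≡0 → to (goodIndex-decides a) (subst₂ (λ d x → a * d ≤ N * x) D̃≡D Ã≡A
                                                 (m∸n≡0⇒m≤n (ifZero-0-1 test≡0))))
    (λ q<α → cong (λ x → ifZero x 0 1) (m≤n⇒m∸n≡0 (subst₂ (λ d x → a * d ≤ N * x) (sym D̃≡D) (sym Ã≡A)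
                                                           (from (goodIndex-decides a) q<α))))
    where
    open Equivalence
    D̃≡D : D Ẽ m ≡ D E m
    D̃≡D = D-cong m goodIndex-exact
    Ã≡A : A Ẽ m ≡ A E m
    Ã≡A = A-cong m goodIndex-exact
    ifZero-0-1 : ∀ {x} → ifZero x 0 1 ≡ 0 → x ≡ 0
    ifZero-0-1 {zero} _ = refl

cutTest-decides : ∀ {E} → (∀ k → 2 ≤ E k) → (∀ k → D E k * D E k ≤ E k) →
  ∀ v → cutTest E v ≡ 0 ⇔ decodeℚ (head v) (head (tail v)) (head (tail (tail v))) <Σ[ E ]
cutTest-decides {E} 2≤E D²≤E (zero  ∷ a ∷ b ∷ []) = cutTest-nonnegative 2≤E D²≤E b a
cutTest-decides {E} 2≤E D²≤E (suc _ ∷ a ∷ b ∷ []) = mk⇔ (λ _ → 0 , negative<partialSum E a b) (λ _ → refl)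

cutTest-0-or-1 : ∀ E v → cutTest E v ≡ 0 ⊎ cutTest E v ≡ 1
cutTest-0-or-1 E (suc _ ∷ a ∷ b ∷ []) = inj₁ refl
cutTest-0-or-1 E (zero  ∷ a ∷ b ∷ []) with a * D (capped E (cap b)) (goodIndex E b)
                                          ∸ suc b * A (capped E (cap b)) (goodIndex E b)
... | zero  = inj₁ refl
... | suc _ = inj₂ refl

cutTest-elementary : ∀ {E} → Elementary₂ (λ k L → E k ⊓ L) → IsElementary 3 (cutTest E)
cutTest-elementary {E} E-capped = el-ext
  (ap₃ ifZero-elementary x₀
    (ap₃ ifZero-elementary
      (ap₂ ∸-elementary (ap₂ *-elementary x₁ (ap₂ D̃ m L))
                        (ap₂ *-elementary (ap₁ suc-elementary x₂) (ap₂ Ã m L)))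
      (el-const 0) (el-const 1))
    (el-const 0))
  λ { (_ ∷ _ ∷ _ ∷ []) → refl }
  where
  D̃ : Elementary₂ (λ k L → D (capped E L) k)
  D̃ = capped-D-elementary E-capped (λ i L → m⊓n≤n (E i) L)
  Ã : Elementary₂ (λ k L → A (capped E L) k)
  Ã = capped-A-elementary E-capped (λ i L → m⊓n≤n (E i) L)
  margin-el : ∀ {n} {b : Vec ℕ n → ℕ} → IsElementary n b → IsElementary n (λ v → margin (b v))
  margin-el eb = ap₂ *-elementary (el-const 2) (ap₁ suc-elementary eb)
  cap-el : ∀ {n} {b : Vec ℕ n → ℕ} → IsElementary n b → IsElementary n (λ v → cap (b v))
  cap-el {n} {b} eb = ap₁ suc-elementary (ap₂ *-elementary (ap₂ *-elementary (ap₂ *-elementary M M) M) M)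
    where
    M : IsElementary n (λ v → margin (b v))
    M = margin-el eb
  goodTest-el : Elementary₂ (λ k b → goodTest E b k)
  goodTest-el = elementary₂ (ap₂ ∸-elementary
    (ap₁ suc-elementary (ap₂ *-elementary (margin-el x₁) (ap₂ D̃ x₀ (cap-el x₁))))
    (ap₂ E-capped x₀ (cap-el x₁)))
  m : IsElementary 3 (λ v → goodIndex E (lookup v (suc (suc zero))))
  m = ap₂ (μ-elementary₂ goodTest-el) (ap₁ suc-elementary (margin-el x₂)) x₂
  L : IsElementary 3 (λ v → cap (lookup v (suc (suc zero))))
  L = cap-el x₂

partialSum-cut-elementary : ∀ {E} → (∀ k → 2 ≤ E k) → (∀ k → D E k * D E k ≤ E k) →
  Elementary₂ (λ k L → E k ⊓ L) →
  ElementaryRel 3 (λ v → decodeℚ (head v) (head (tail v)) (head (tail (tail v))) <Σ[ E ])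
partialSum-cut-elementary {E} 2≤E D²≤E E-capped =
  cutTest E , cutTest-elementary E-capped , cutTest-0-or-1 E , cutTest-decides 2≤E D²≤E

-- The series α^f

m+n*n≤[n+1]³ : ∀ {m} n → m ≤ n → m + n * n ≤ (n + 1) ^ 3
m+n*n≤[n+1]³ {m} n m≤n = begin
  m + n * n                                        ≤⟨ +-monoˡ-≤ (n * n) m≤n ⟩
  n + n * n                                        ≤⟨ m≤m+n (n + n * n) _ ⟩
  n + n * n + (n * n * n + 2 * (n * n) + 2 * n + 1) ≡⟨ expand n ⟩
  (n + 1) ^ 3                                      ∎
  where
  open ≤-Reasoning
  expand : ∀ n → n + n * n + (n * n * n + 2 * (n * n) + 2 * n + 1) ≡ (n + 1) * ((n + 1) * ((n + 1) * 1))
  expand = solve-∀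

module _ {p h : ℕ → ℕ} (2≤p : ∀ k → 2 ≤ p k) (p≤h : ∀ k → p k ≤ h k)
         (h-grows : ∀ k → 2 * (h k + 1) ^ 3 ≤ h (suc k)) where

  private
    E : ℕ → ℕ
    E k = p k ^ h k

  2≤p^h : ∀ k → 2 ≤ p k ^ h k
  2≤p^h k = ≤-trans (2≤p k) (m≤m^n (p k) (≤-trans (s≤s z≤n) (≤-trans (2≤p k) (p≤h k))))

  private
    p^h≤2^[h*h] : ∀ k → E k ≤ 2 ^ (h k * h k)
    p^h≤2^[h*h] k = ≤-trans (^-monoˡ-≤ (h k) (p≤h k)) (m^n≤2^[m*n] (h k) (h k))

    [h+1]³≤h[1+k] : ∀ k → (h k + 1) ^ 3 ≤ h (suc k)
    [h+1]³≤h[1+k] k = ≤-trans (m≤m+n _ _) (h-grows k)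

    D[1+k]≤2^[h+1]³ : ∀ k → D E (suc k) ≤ 2 ^ ((h k + 1) ^ 3)
    D[1+k]≤2^[h+1]³ zero = begin
      1 * E 0                ≡⟨ *-identityˡ (E 0) ⟩
      E 0                    ≤⟨ p^h≤2^[h*h] 0 ⟩
      2 ^ (h 0 * h 0)        ≤⟨ ^-monoʳ-≤ 2 (m+n*n≤[n+1]³ {0} (h 0) z≤n) ⟩
      2 ^ ((h 0 + 1) ^ 3)    ∎
      where open ≤-Reasoning
    D[1+k]≤2^[h+1]³ (suc k) = begin
      D E (suc k) * E (suc k)             ≤⟨ *-mono-≤ (D[1+k]≤2^[h+1]³ k) (p^h≤2^[h*h] (suc k)) ⟩
      2 ^ c * 2 ^ (h′ * h′)               ≡⟨ sym (^-distribˡ-+-* 2 c (h′ * h′)) ⟩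
      2 ^ (c + h′ * h′)                   ≤⟨ ^-monoʳ-≤ 2 (m+n*n≤[n+1]³ h′ ([h+1]³≤h[1+k] k)) ⟩
      2 ^ ((h′ + 1) ^ 3)                  ∎
      where
      open ≤-Reasoning
      c h′ : ℕ
      c = (h k + 1) ^ 3
      h′ = h (suc k)

  D²≤p^h : ∀ k → D E k * D E k ≤ E k
  D²≤p^h zero    = ≤-trans (s≤s z≤n) (2≤p^h 0)
  D²≤p^h (suc k) = begin
    D E (suc k) * D E (suc k)   ≤⟨ *-mono-≤ (D[1+k]≤2^[h+1]³ k) (D[1+k]≤2^[h+1]³ k) ⟩
    2 ^ c * 2 ^ c               ≡⟨ sym (^-distribˡ-+-* 2 c c) ⟩
    2 ^ (c + c)                 ≤⟨ ^-monoʳ-≤ 2 (≤-trans (+-monoʳ-≤ c (m≤m+n c 0)) (h-grows k)) ⟩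
    2 ^ h (suc k)               ≤⟨ ^-monoˡ-≤ (h (suc k)) (2≤p (suc k)) ⟩
    E (suc k)                   ∎
    where
    open ≤-Reasoning
    c : ℕ
    c = (h k + 1) ^ 3

graph⇒capped-elementary : {F : ℕ → ℕ} → ElementaryRel 2 (λ v → F (head v) ≡ head (tail v)) →
                          Elementary₂ (λ i L → F i ⊓ L)
graph⇒capped-elementary {F} (χ , χ-elementary , _ , χ≡0⇔graph) =
  elementary₂ (el-ext (ap₂ search x₁ x₀) λ { (i ∷ L ∷ []) → μ-graph (λ y → χ≡0⇔graph (i ∷ y ∷ [])) L })
  where
  graph : Elementary₂ (λ i y → χ (i ∷ y ∷ []))
  graph = elementary₂ (el-ext χ-elementary λ { (_ ∷ _ ∷ []) → refl })
  search : Elementary₂ (λ L i → μ (λ y → χ (i ∷ y ∷ [])) L)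
  search = μ-elementary₂ {t = λ y i → χ (i ∷ y ∷ [])} (elementary₂ (ap₂ graph x₁ x₀))

module _ {f : ℕ → ℕ} (f-step : ∀ x → f x ≤ f (suc x)) (2^x≤f : ∀ x → 2 ^ x ≤ f x) where

  P≤h : ∀ k → P k ≤ hf f k
  P≤h k = ≤-trans (P≤g[1+j] k) (g-monotone (+-monoˡ-≤ k (≤-trans (m^n>0 2 k) (2^x≤f k))))

  h-grows : ∀ k → 2 * (hf f k + 1) ^ 3 ≤ hf f (suc k)
  h-grows k = ≤-trans (2[g+1]³≤g[1+j] (f k + k))
    (g-monotone (subst (suc (f k + k) ≤_) (sym (+-suc (f (suc k)) k)) (s≤s (+-monoˡ-≤ k (f-step k)))))

  P^h-capped-elementary : Elementary₂ (λ i L → f i ⊓ L) → Elementary₂ (λ k L → P k ^ hf f k ⊓ L)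
  P^h-capped-elementary f-capped = elementary₂ (el-ext
    (ap₂ ⊓-elementary
      (ap₂ ^-elementary (ap₂ P-capped-elementary x₀ x₁)
                        (ap₂ g-capped-elementary (ap₂ +-elementary (ap₂ f-capped x₀ x₁) x₀) x₁))
      x₁)
    λ { (k ∷ L ∷ []) → capped-formula k L })
    where
    capped-formula : ∀ k L → (P k ⊓ L) ^ (g (f k ⊓ L + k) ⊓ L) ⊓ L ≡ P k ^ hf f k ⊓ L
    capped-formula k L rewrite g[m⊓n+k]⊓n≡g[m+k]⊓n (f k) L k =
      [m⊓n]^[k⊓n]⊓n≡m^k⊓n (P k) L (2≤P k) (≤-trans (s≤s z≤n) (≤-trans (2≤P k) (P≤h k)))

αₙ≡partialSum : ∀ f n → αₙ f n ≡ partialSum (λ i → P i ^ hf f i) n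
αₙ≡partialSum f zero    = refl
αₙ≡partialSum f (suc n) = cong (_+q inv (P (suc n) ^ hf f (suc n))) (αₙ≡partialSum f n)

<Σ⇔<α : ∀ f q → q <Σ[ (λ i → P i ^ hf f i) ] ⇔ q <α[ f ]
<Σ⇔<α f q = mk⇔ (λ (n , q<) → n , subst (q <q_) (sym (αₙ≡partialSum f n)) q<)
                (λ (n , q<) → n , subst (q <q_) (αₙ≡partialSum f n) q<)

corollary1 : (f : ℕ → ℕ) → Honest f → DedekindCutElementary f
corollary1 f (f-step , 2^x≤f , graph-elementary) =
  ElementaryRel-cong (λ _ → <Σ⇔<α f _)
    (partialSum-cut-elementary (2≤p^h 2≤P P≤h′ h-grows′) (D²≤p^h 2≤P P≤h′ h-grows′)
                               (P^h-capped-elementary f-step 2^x≤f (graph⇒capped-elementary graph-elementary)))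
  where
  P≤h′ : ∀ k → P k ≤ hf f k
  P≤h′ = P≤h f-step 2^x≤f
  h-grows′ : ∀ k → 2 * (hf f k + 1) ^ 3 ≤ hf f (suc k)
  h-grows′ = h-grows f-step 2^x≤f
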